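{- Let $\mathcal X$ be a zero-nonzero pattern and let $\mathcal Y$ be obtained by appending a column $e$ to $\mathcal X$ whose zero set is the intersection of the zero sets of the columns in some subset $A$ of the columns of $\mathcal X$. Suppose that $M\in\mathcal R(\mathcal X)$ and that $M'$ is obtained from $M$ by freely adding a point $e$ to the closure of $A$. Then, with $E(M')$ labeled so that this new point corresponds to the new column, $M'\in\mathcal R(\mathcal Y)$.
   Context: A zero-nonzero pattern is a matrix with entries in $\{0,*\}$. The zero set of a row is the set of column labels where it has entry $0$; the zero set of a column is the set of row labels where it has entry $0$. For a pattern $\mathcal X$, $\mathcal R(\mathcal X)$ is the set of matroids on the set of column labels of $\mathcal X$ such that the zero set of every row is a flat. Freely adding a point $e$ to the closure of $A$ means forming the single-element extension $M+_{\mathcal M}e$, where $\mathcal M$ is the modular cut of $M$ consisting of all flats of $M$ containing $A$. -}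

module Defs where

open import Data.Nat using (ℕ; zero; suc; _+_; _≤_; _<_)
open import Data.Fin using (Fin; zero; suc)
open import Data.Fin.Subset using (Subset; _∈_; _∉_; _⊆_; _∪_; _∩_; ⁅_⁆; ∣_∣; inside; outside)
open import Data.Vec using (_∷_; tabulate)
open import Data.Product using (_×_)
open import Function.Bundles using (_⇔_)
open import Relation.Binary.PropositionalEquality using (_≡_)

data ZN : Set where
  𝟎 : ZN
  ✱ : ZN

Pattern : ℕ → ℕ → Set
Pattern m n = Fin m → Fin n → ZN

isZero : ZN → Data.Fin.Subset.Side
isZero 𝟎 = inside
isZero ✱ = outside

rowZeroSet : ∀ {m n} → Pattern m n → Fin m → Subset n
rowZeroSet X i = tabulate (λ j → isZero (X i j))

colZeroSet : ∀ {m n} → Pattern m n → Fin n → Subset m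
colZeroSet X j = tabulate (λ i → isZero (X i j))

record Matroid (n : ℕ) : Set where
  field
    rank        : Subset n → ℕ
    rank-bound  : ∀ X → rank X ≤ ∣ X ∣
    rank-mono   : ∀ {X Y} → X ⊆ Y → rank X ≤ rank Y
    rank-submod : ∀ X Y → rank (X ∪ Y) + rank (X ∩ Y) ≤ rank X + rank Y

open Matroid public

IsFlat : ∀ {n} → Matroid n → Subset n → Set
IsFlat M F = ∀ x → x ∉ F → rank M F < rank M (F ∪ ⁅ x ⁆)

_∈cl[_]_ : ∀ {n} → Fin n → Matroid n → Subset n → Set
x ∈cl[ M ] X = rank M (X ∪ ⁅ x ⁆) ≡ rank M X

InR : ∀ {m n} → Pattern m n → Matroid n → Set
InR X M = ∀ i → IsFlat M (rowZeroSet X i)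

-- Single-element extensions.  The ground set of the extension is
-- Fin (suc n); the new element e is `zero`, old element j is `suc j`.
-- A subset X of Fin n corresponds to `outside ∷ X`.

IsExtensionByCut : ∀ {n} → Matroid n → (Subset n → Set) → Matroid (suc n) → Set
IsExtensionByCut {n} M 𝓜 M' =
  (∀ (X : Subset n) → rank M' (outside ∷ X) ≡ rank M X)
  × (∀ (F : Subset n) → IsFlat M F → (zero ∈cl[ M' ] (outside ∷ F) ⇔ 𝓜 F))

flatsContaining : ∀ {n} → Matroid n → Subset n → Subset n → Set
flatsContaining M A F = IsFlat M F × A ⊆ F

IsFreeAdditionToClosure : ∀ {n} → Matroid n → Subset n → Matroid (suc n) → Set
IsFreeAdditionToClosure M A M' = IsExtensionByCut M (flatsContaining M A) M'

-- A flat F of M stays a flat of the free extension: it is F + e in M' when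
-- F contains A (e then lies in its closure, so the rank does not grow) and F
-- itself otherwise (e is outside its closure).  The zero set of row i of Y is
-- exactly of this shape: it contains e iff i lies in the zero set of every
-- column of A, i.e. iff the zero set of row i of X contains A.
module Submission where

open import Defs
open import Data.Nat using (suc)
open import Data.Nat.Properties using (≤∧≢⇒<; module ≤-Reasoning)
open import Data.Fin using (Fin; zero; suc)
open import Data.Fin.Subset using (Subset; _∈_; _⊆_; _∪_; ⁅_⁆; ⊥; inside; outside; Side)
open import Data.Fin.Subset.Properties using (∪-identityʳ; p⊆p∪q)
open import Data.Vec using (_∷_; tabulate)
open import Data.Vec.Base using (here; there)
open import Data.Vec.Properties using (lookup⇒[]=; []=⇒lookup; lookup∘tabulate; tabulate-cong)
open import Data.Product using (_,_; proj₁; proj₂)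
open import Data.Empty using (⊥-elim)
open import Relation.Nullary using (¬_)
open import Function.Bundles using (_⇔_; mk⇔; Equivalence)
open import Relation.Binary.PropositionalEquality
  using (_≡_; _≢_; refl; sym; trans; cong; subst; module ≡-Reasoning)

open Equivalence

∈-tabulate⇔ : ∀ {n} (f : Fin n → Side) i → i ∈ tabulate f ⇔ f i ≡ inside
∈-tabulate⇔ f i = mk⇔
  (λ p → trans (sym (lookup∘tabulate f i)) ([]=⇒lookup p))
  (λ e → lookup⇒[]= i (tabulate f) (trans (lookup∘tabulate f i) e))

isZero≡inside⇔≡𝟎 : ∀ z → isZero z ≡ inside ⇔ z ≡ 𝟎
isZero≡inside⇔≡𝟎 𝟎 = mk⇔ (λ _ → refl) (λ _ → refl)
isZero≡inside⇔≡𝟎 ✱ = mk⇔ (λ ()) (λ ())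

∈-rowZeroSet⇔ : ∀ {m n} (X : Pattern m n) i j → j ∈ rowZeroSet X i ⇔ X i j ≡ 𝟎
∈-rowZeroSet⇔ X i j = mk⇔
  (λ p → to (isZero≡inside⇔≡𝟎 _) (to (∈-tabulate⇔ _ j) p))
  (λ e → from (∈-tabulate⇔ _ j) (from (isZero≡inside⇔≡𝟎 _) e))

∈-colZeroSet⇔ : ∀ {m n} (X : Pattern m n) i j → i ∈ colZeroSet X j ⇔ X i j ≡ 𝟎
∈-colZeroSet⇔ X i j = mk⇔
  (λ p → to (isZero≡inside⇔≡𝟎 _) (to (∈-tabulate⇔ _ i) p))
  (λ e → from (∈-tabulate⇔ _ i) (from (isZero≡inside⇔≡𝟎 _) e))

⊆-rowZeroSet⇔ : ∀ {m n} (X : Pattern m n) (A : Subset n) i →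
  A ⊆ rowZeroSet X i ⇔ (∀ j → j ∈ A → i ∈ colZeroSet X j)
⊆-rowZeroSet⇔ X A i = mk⇔
  (λ A⊆Z j j∈A → from (∈-colZeroSet⇔ X i j) (to (∈-rowZeroSet⇔ X i j) (A⊆Z j∈A)))
  (λ h {j} j∈A → from (∈-rowZeroSet⇔ X i j) (to (∈-colZeroSet⇔ X i j) (h j j∈A)))

rowZeroSet-prependColumn : ∀ {m n} (X : Pattern m n) (Y : Pattern m (suc n)) →
  (∀ i j → Y i (suc j) ≡ X i j) →
  ∀ i → rowZeroSet Y i ≡ isZero (Y i zero) ∷ rowZeroSet X i
rowZeroSet-prependColumn X Y Y≗X i =
  cong (isZero (Y i zero) ∷_) (tabulate-cong (λ j → cong isZero (Y≗X i j)))

module SingleElementExtension {n} {M : Matroid n} {𝓜 : Subset n → Set}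
  {M' : Matroid (suc n)} (ext : IsExtensionByCut M 𝓜 M') where

  private
    deletion : ∀ (F : Subset n) → rank M' (outside ∷ F) ≡ rank M F
    deletion = proj₁ ext

    new∈cl⇔ : ∀ F → IsFlat M F → (zero ∈cl[ M' ] (outside ∷ F) ⇔ 𝓜 F)
    new∈cl⇔ = proj₂ ext

  rank-with-new : ∀ F → IsFlat M F → 𝓜 F → rank M' (inside ∷ F) ≡ rank M F
  rank-with-new F flat F∈𝓜 = begin
    rank M' (inside ∷ F)       ≡⟨ cong (λ W → rank M' (inside ∷ W)) (sym (∪-identityʳ F)) ⟩
    rank M' (inside ∷ F ∪ ⊥)  ≡⟨ from (new∈cl⇔ F flat) F∈𝓜 ⟩
    rank M' (outside ∷ F)      ≡⟨ deletion F ⟩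
    rank M F                   ∎
    where open ≡-Reasoning

  flat-with-new : ∀ F → IsFlat M F → 𝓜 F → IsFlat M' (inside ∷ F)
  flat-with-new F flat F∈𝓜 zero p = ⊥-elim (p here)
  flat-with-new F flat F∈𝓜 (suc j) p = begin-strict
    rank M' (inside ∷ F)              ≡⟨ rank-with-new F flat F∈𝓜 ⟩
    rank M F                          <⟨ flat j (λ q → p (there q)) ⟩
    rank M (F ∪ ⁅ j ⁆)                ≡⟨ sym (deletion (F ∪ ⁅ j ⁆)) ⟩
    rank M' (outside ∷ F ∪ ⁅ j ⁆)     ≤⟨ rank-mono M' (λ { (there q) → there q }) ⟩
    rank M' (inside ∷ F ∪ ⁅ j ⁆)      ∎
    where open ≤-Reasoning

  flat-without-new : ∀ F → IsFlat M F → ¬ 𝓜 F → IsFlat M' (outside ∷ F)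
  flat-without-new F flat F∉𝓜 zero p =
    ≤∧≢⇒< (rank-mono M' (p⊆p∪q _)) (λ e → F∉𝓜 (to (new∈cl⇔ F flat) (sym e)))
  flat-without-new F flat F∉𝓜 (suc j) p = begin-strict
    rank M' (outside ∷ F)             ≡⟨ deletion F ⟩
    rank M F                          <⟨ flat j (λ q → p (there q)) ⟩
    rank M (F ∪ ⁅ j ⁆)                ≡⟨ sym (deletion (F ∪ ⁅ j ⁆)) ⟩
    rank M' (outside ∷ F ∪ ⁅ j ⁆)     ∎
    where open ≤-Reasoning

lemma4p7 : ∀ {m n} (X : Pattern m n) (A : Subset n) (Y : Pattern m (suc n))
    → (∀ i j → Y i (suc j) ≡ X i j)
    → (∀ i → (i ∈ colZeroSet Y zero) ⇔ (∀ j → j ∈ A → i ∈ colZeroSet X j))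
    → (M : Matroid n) → InR X M
    → (M' : Matroid (suc n)) → IsFreeAdditionToClosure M A M'
    → InR Y M'
lemma4p7 X A Y Y≗X e-zeros M M∈R M' ext i =
  subst (IsFlat M') (sym (rowZeroSet-prependColumn X Y Y≗X i)) (flat (Y i zero) refl)
  where
  open SingleElementExtension {M = M} {M' = M'} ext
  Z = rowZeroSet X i

  A⊆Z⇔Yie≡𝟎 : A ⊆ Z ⇔ Y i zero ≡ 𝟎
  A⊆Z⇔Yie≡𝟎 = mk⇔
    (λ (A⊆Z : A ⊆ Z) → to (∈-colZeroSet⇔ Y i zero) (from (e-zeros i) (to (⊆-rowZeroSet⇔ X A i) A⊆Z)))
    (λ e → from (⊆-rowZeroSet⇔ X A i) (to (e-zeros i) (from (∈-colZeroSet⇔ Y i zero) e)))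

  flat : ∀ z → Y i zero ≡ z → IsFlat M' (isZero z ∷ Z)
  flat 𝟎 e = flat-with-new Z (M∈R i) (M∈R i , from A⊆Z⇔Yie≡𝟎 e)
  flat ✱ e = flat-without-new Z (M∈R i) λ Z∈𝓜 → ✱≢𝟎 (trans (sym e) (to A⊆Z⇔Yie≡𝟎 (proj₂ Z∈𝓜)))
    where
    ✱≢𝟎 : ✱ ≢ 𝟎
    ✱≢𝟎 ()
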